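{- Let $(F_n)_{n\in\mathbb{N}}$ be a linear-like semiring family of graphs, let $G,H$ be graphs and $n\in\mathbb{N}$. If there is a graph homomorphism $G+H\to F_n$, then there are $k,\ell\in\mathbb{N}$ with $n=k+\ell$ such that $G\to F_k$ and $H\to F_\ell$.
   Context: Graphs are undirected simple graphs, possibly infinite; $X\to Y$ denotes existence of a graph homomorphism; $\omega$ is the clique number. The join $G+H$ is the disjoint union with all edges between the two parts added; the disjunctive product $G\ast H$ has vertex set $V(G)\times V(H)$ with $(v,w)\sim(v',w')$ iff $v\sim v'$ or $w\sim w'$. A semiring family is a sequence $(F_n)_{n\in\mathbb{N}}$ with $F_0=\emptyset$, $F_1\ne\emptyset$, $F_n+F_m\to F_{n+m}$, $F_n\ast F_m\to F_{nm}$. For $S\subseteq V(G)$, $S^\perp$ is the set of vertices adjacent to all vertices of $S$; $S$ is a flat if $S^{\perp\perp}=S$; $\mathrm{rk}(S)=\omega(S^{\perp\perp})$. $(F_n)$ is linear-like if for every $n$ and every flat $S\subseteq V(F_n)$, the induced subgraph on $S$ is homomorphically equivalent to $F_{\mathrm{rk}(S)}$. -}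

module Defs where

open import Data.Nat using (ℕ; _+_; _*_)
open import Data.Fin using (Fin)
open import Data.Empty using (⊥)
open import Data.Unit using (⊤)
open import Data.Sum using (_⊎_; inj₁; inj₂)
open import Data.Product using (Σ; ∃; _×_; _,_; proj₁)
open import Relation.Nullary using (¬_)
open import Relation.Binary.PropositionalEquality using (_≡_)

record Graph : Set₁ where
  field
    V    : Set
    _~_  : V → V → Set
    sym  : ∀ {u v} → u ~ v → v ~ u
    irr  : ∀ {v} → ¬ (v ~ v)
open Graph public

record Hom (G H : Graph) : Set where
  field
    map      : V G → V H
    preserve : ∀ {u v} → _~_ G u v → _~_ H (map u) (map v)

_⟶_ : Graph → Graph → Set
G ⟶ H = Hom G H

_⟷_ : Graph → Graph → Set
G ⟷ H = (G ⟶ H) × (H ⟶ G)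

joinAdj : (G H : Graph) → V G ⊎ V H → V G ⊎ V H → Set
joinAdj G H (inj₁ a) (inj₁ b) = _~_ G a b
joinAdj G H (inj₂ a) (inj₂ b) = _~_ H a b
joinAdj G H (inj₁ _) (inj₂ _) = ⊤
joinAdj G H (inj₂ _) (inj₁ _) = ⊤

joinSym : (G H : Graph) → ∀ {u v} → joinAdj G H u v → joinAdj G H v u
joinSym G H {inj₁ a} {inj₁ b} e = sym G e
joinSym G H {inj₂ a} {inj₂ b} e = sym H e
joinSym G H {inj₁ _} {inj₂ _} e = _
joinSym G H {inj₂ _} {inj₁ _} e = _

joinIrr : (G H : Graph) → ∀ {v} → ¬ joinAdj G H v v
joinIrr G H {inj₁ a} = irr G
joinIrr G H {inj₂ a} = irr H

_⊕_ : Graph → Graph → Graph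
G ⊕ H = record
  { V = V G ⊎ V H ; _~_ = joinAdj G H ; sym = λ {u} {v} → joinSym G H {u} {v} ; irr = λ {v} → joinIrr G H {v} }

disjSym : (G H : Graph) → ∀ {u v : V G × V H} →
  (_~_ G (Data.Product.proj₁ u) (Data.Product.proj₁ v) ⊎ _~_ H (Data.Product.proj₂ u) (Data.Product.proj₂ v)) →
  (_~_ G (Data.Product.proj₁ v) (Data.Product.proj₁ u) ⊎ _~_ H (Data.Product.proj₂ v) (Data.Product.proj₂ u))
disjSym G H (inj₁ e) = inj₁ (sym G e)
disjSym G H (inj₂ e) = inj₂ (sym H e)

disjIrr : (G H : Graph) → ∀ {v : V G × V H} →
  ¬ (_~_ G (Data.Product.proj₁ v) (Data.Product.proj₁ v) ⊎ _~_ H (Data.Product.proj₂ v) (Data.Product.proj₂ v))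
disjIrr G H (inj₁ e) = irr G e
disjIrr G H (inj₂ e) = irr H e

_⊛_ : Graph → Graph → Graph
G ⊛ H = record
  { V = V G × V H
  ; _~_ = λ u v → _~_ G (Data.Product.proj₁ u) (Data.Product.proj₁ v) ⊎ _~_ H (Data.Product.proj₂ u) (Data.Product.proj₂ v)
  ; sym = λ {u} {v} → disjSym G H {u} {v} ; irr = λ {v} → disjIrr G H {v} }

record SemiringFamily (F : ℕ → Graph) : Set where
  field
    F0-empty    : ¬ V (F 0)
    F1-nonempty : V (F 1)
    join-hom    : ∀ n m → (F n ⊕ F m) ⟶ F (n + m)
    prod-hom    : ∀ n m → (F n ⊛ F m) ⟶ F (n * m)

Subset : Graph → Set₁
Subset G = V G → Set

_⊥ˢ : {G : Graph} → Subset G → Subset G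
_⊥ˢ {G} S v = ∀ u → S u → _~_ G v u

IsFlat : (G : Graph) → Subset G → Set
IsFlat G S = ∀ v → ((_⊥ˢ {G} (_⊥ˢ {G} S)) v → S v) × (S v → (_⊥ˢ {G} (_⊥ˢ {G} S)) v)

Induced : (G : Graph) → Subset G → Graph
Induced G S = record
  { V = Σ (V G) S
  ; _~_ = λ u v → _~_ G (proj₁ u) (proj₁ v)
  ; sym = sym G ; irr = irr G }

Clique : Graph → ℕ → Set
Clique G r = Σ (Fin r → V G) λ c → ∀ i j → ¬ (i ≡ j) → _~_ G (c i) (c j)

HasCliqueNumber : Graph → ℕ → Set
HasCliqueNumber G r = Clique G r × ¬ Clique G (Data.Nat.suc r)

HasRank : (G : Graph) → Subset G → ℕ → Set
HasRank G S r = HasCliqueNumber (Induced G (_⊥ˢ {G} (_⊥ˢ {G} S))) r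

LinearLike : (ℕ → Graph) → Set₁
LinearLike F = ∀ n (S : Subset (F n)) → IsFlat (F n) S →
  Σ ℕ λ r → HasRank (F n) S r × (Induced (F n) S ⟷ F r)

-- Send the image A of H under G + H → F n to the flat A^⊥, which receives G,
-- and to the flat A^⊥⊥, which receives H. Linear-likeness maps them to F k and
-- F l, and since every vertex of A^⊥ is adjacent to every vertex of A^⊥⊥, their
-- maximum cliques combine to a (k + l)-clique of F n, so k + l ≤ ω(F n) ≤ n;
-- pad l up to n ∸ k with F l → F l + F d → F (l + d).
--
-- If ω(F n) = n + b, split a
-- maximum clique into an n-part and a b-part B. The flat B^⊥ contains the
-- n-part, and its maximum cliques extend by B, so its rank is exactly n. Hence
-- F n maps into B^⊥, and with it the whole (n + b)-clique, forcing b = 0.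
module Submission where

open import Defs
open import Data.Nat using (ℕ; suc; _+_; _≤_)
open import Data.Nat.Properties using (≤-total; ≤-trans; ≤-reflexive; ≤-antisym; +-cancelʳ-≤; +-assoc; ≰⇒>; _≤?_; m≤n⇒∃[o]m+o≡n)
open import Data.Fin using (Fin; splitAt; join; _↑ˡ_; _↑ʳ_; inject≤)
open import Data.Fin.Properties using (splitAt-↑ˡ; splitAt-↑ʳ; splitAt⁻¹-↑ˡ; splitAt⁻¹-↑ʳ; ↑ˡ-injective; ↑ʳ-injective; inject≤-injective)
open import Data.Product using (Σ; ∃; _×_; _,_; proj₁; proj₂)
open import Data.Sum using (inj₁; inj₂)
open import Data.Unit using (tt)
open import Data.Empty using (⊥-elim)
open import Relation.Nullary using (¬_; yes; no)
open import Relation.Unary using (_⊆_; U)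
open import Relation.Binary.PropositionalEquality using (_≡_; _≢_; refl; cong; subst; ≢-sym)
  renaming (sym to ≡-sym; trans to ≡-trans)

infixr 9 _∘ʰ_

_∘ʰ_ : {G H K : Graph} → H ⟶ K → G ⟶ H → G ⟶ K
g ∘ʰ f = record
  { map = λ v → Hom.map g (Hom.map f v)
  ; preserve = λ e → Hom.preserve g (Hom.preserve f e) }

idʰ : {G : Graph} → G ⟶ G
idʰ = record { map = λ v → v ; preserve = λ e → e }

inj₁ʰ : {G H : Graph} → G ⟶ (G ⊕ H)
inj₁ʰ = record { map = inj₁ ; preserve = λ e → e }

inj₂ʰ : {G H : Graph} → H ⟶ (G ⊕ H)
inj₂ʰ = record { map = inj₂ ; preserve = λ e → e }

_⊕ʰ_ : {G G′ H H′ : Graph} → G ⟶ G′ → H ⟶ H′ → (G ⊕ H) ⟶ (G′ ⊕ H′)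
_⊕ʰ_ {G} {G′} {H} {H′} f g = record { map = map ; preserve = λ {u} {v} → preserve {u} {v} }
  where
  map : V (G ⊕ H) → V (G′ ⊕ H′)
  map (inj₁ x) = inj₁ (Hom.map f x)
  map (inj₂ y) = inj₂ (Hom.map g y)
  preserve : ∀ {u v} → _~_ (G ⊕ H) u v → _~_ (G′ ⊕ H′) (map u) (map v)
  preserve {inj₁ _} {inj₁ _} e = Hom.preserve f e
  preserve {inj₂ _} {inj₂ _} e = Hom.preserve g e
  preserve {inj₁ _} {inj₂ _} _ = tt
  preserve {inj₂ _} {inj₁ _} _ = tt

module _ (W : Graph) where

  corestrict : {G : Graph} {P : Subset W} (f : G ⟶ W) →
    (∀ v → P (Hom.map f v)) → G ⟶ Induced W P
  corestrict f inP = record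
    { map = λ v → Hom.map f v , inP v ; preserve = Hom.preserve f }

  Induced-⊆ : {P Q : Subset W} → P ⊆ Q → Induced W P ⟶ Induced W Q
  Induced-⊆ P⊆Q = record { map = λ (v , p) → v , P⊆Q p ; preserve = λ e → e }

  Induced-incl : {P : Subset W} → Induced W P ⟶ W
  Induced-incl = record { map = proj₁ ; preserve = λ e → e }

  Image : {G : Graph} → G ⟶ W → Subset W
  Image {G} f w = Σ (V G) λ v → Hom.map f v ≡ w

  _⊥ : Subset W → Subset W
  S ⊥ = _⊥ˢ {W} S

  ⊆-⊥⊥ : {S : Subset W} → S ⊆ S ⊥ ⊥
  ⊆-⊥⊥ s u u⊥S = sym W (u⊥S _ s)

  ⊥-isFlat : (S : Subset W) → IsFlat W (S ⊥)
  ⊥-isFlat S v = (λ v⊥S⊥⊥ u s → v⊥S⊥⊥ u (⊆-⊥⊥ s)) , ⊆-⊥⊥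

  flat-⊥⊥⊆ : {S : Subset W} → IsFlat W S → S ⊥ ⊥ ⊆ S
  flat-⊥⊥⊆ flat {v} = proj₁ (flat v)

  Induced-⊕ : {P Q : Subset W} → P ⊆ Q ⊥ → (Induced W P ⊕ Induced W Q) ⟶ W
  Induced-⊕ {P} {Q} P⊆Q⊥ = record { map = map ; preserve = λ {u} {v} → preserve {u} {v} }
    where
    map : V (Induced W P ⊕ Induced W Q) → V W
    map (inj₁ (v , _)) = v
    map (inj₂ (v , _)) = v
    preserve : ∀ {u v} → _~_ (Induced W P ⊕ Induced W Q) u v → _~_ W (map u) (map v)
    preserve {inj₁ _} {inj₁ _} e = e
    preserve {inj₂ _} {inj₂ _} e = e
    preserve {inj₁ (_ , p)} {inj₂ (v , q)} _ = P⊆Q⊥ p v q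
    preserve {inj₂ (u , q)} {inj₁ (_ , p)} _ = sym W (P⊆Q⊥ p u q)

  module _ {G H : Graph} (φ : (G ⊕ H) ⟶ W) where

    ⊕⟶Image : H ⟶ Induced W (Image (φ ∘ʰ inj₂ʰ))
    ⊕⟶Image = corestrict (φ ∘ʰ inj₂ʰ) λ h → h , refl

    ⊕⟶Image⊥ : G ⟶ Induced W (Image (φ ∘ʰ inj₂ʰ) ⊥)
    ⊕⟶Image⊥ = corestrict (φ ∘ʰ inj₁ʰ) λ { g _ (h , refl) → Hom.preserve φ {inj₁ g} {inj₂ h} tt }

Complete : ℕ → Graph
Complete r = record { V = Fin r ; _~_ = _≢_ ; sym = ≢-sym ; irr = λ i≢i → i≢i refl }

Clique⇒⟶ : (G : Graph) {r : ℕ} → Clique G r → Complete r ⟶ G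
Clique⇒⟶ G (c , adj) = record { map = c ; preserve = λ {i} {j} → adj i j }

⟶⇒Clique : {G : Graph} {r : ℕ} → Complete r ⟶ G → Clique G r
⟶⇒Clique f = Hom.map f , λ i j → Hom.preserve f

inject≤ʰ : {k m : ℕ} → k ≤ m → Complete k ⟶ Complete m
inject≤ʰ k≤m = record
  { map = λ i → inject≤ i k≤m
  ; preserve = λ {i} {j} i≢j eq → i≢j (inject≤-injective k≤m k≤m i j eq) }

↑ˡ≢↑ʳ : (a b : ℕ) (i : Fin a) (j : Fin b) → i ↑ˡ b ≢ a ↑ʳ j
↑ˡ≢↑ʳ a b i j eq with ≡-trans (≡-sym (splitAt-↑ˡ a i b)) (≡-trans (cong (splitAt a) eq) (splitAt-↑ʳ a b j))
... | ()

joinʰ : (a b : ℕ) → (Complete a ⊕ Complete b) ⟶ Complete (a + b)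
joinʰ a b = record { map = join a b ; preserve = λ {u} {v} → preserve {u} {v} }
  where
  preserve : ∀ {u v} → _~_ (Complete a ⊕ Complete b) u v → join a b u ≢ join a b v
  preserve {inj₁ i} {inj₁ j} i≢j eq = i≢j (↑ˡ-injective b i j eq)
  preserve {inj₂ i} {inj₂ j} i≢j eq = i≢j (↑ʳ-injective a i j eq)
  preserve {inj₁ i} {inj₂ j} _ = ↑ˡ≢↑ʳ a b i j
  preserve {inj₂ i} {inj₁ j} _ = ≢-sym (↑ˡ≢↑ʳ a b j i)

splitAtʰ : (a b : ℕ) → Complete (a + b) ⟶ (Complete a ⊕ Complete b)
splitAtʰ a b = record { map = splitAt a ; preserve = λ {i} {j} → preserve i j }
  where
  preserve : ∀ i j → i ≢ j → _~_ (Complete a ⊕ Complete b) (splitAt a i) (splitAt a j)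
  preserve i j i≢j with splitAt a i in eqi | splitAt a j in eqj
  ... | inj₁ x | inj₁ y = λ { refl → i≢j (≡-trans (≡-sym (splitAt⁻¹-↑ˡ eqi)) (splitAt⁻¹-↑ˡ eqj)) }
  ... | inj₂ x | inj₂ y = λ { refl → i≢j (≡-trans (≡-sym (splitAt⁻¹-↑ʳ eqi)) (splitAt⁻¹-↑ʳ eqj)) }
  ... | inj₁ _ | inj₂ _ = tt
  ... | inj₂ _ | inj₁ _ = tt

Clique-map : {G H : Graph} {r : ℕ} → G ⟶ H → Clique G r → Clique H r
Clique-map {G} f K = ⟶⇒Clique (f ∘ʰ Clique⇒⟶ G K)

module _ (G : Graph) where

  Clique-≤ : {k m : ℕ} → k ≤ m → Clique G m → Clique G k
  Clique-≤ k≤m K = ⟶⇒Clique (Clique⇒⟶ G K ∘ʰ inject≤ʰ k≤m)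

  Clique-size≤ : {m c : ℕ} → Clique G m → ¬ Clique G (suc c) → m ≤ c
  Clique-size≤ {m} {c} K noClique with m ≤? c
  ... | yes m≤c = m≤c
  ... | no m≰c = ⊥-elim (noClique (Clique-≤ (≰⇒> m≰c) K))

  Clique-⊕ : (H : Graph) {a b : ℕ} → Clique G a → Clique H b → Clique (G ⊕ H) (a + b)
  Clique-⊕ H {a} {b} K L = ⟶⇒Clique ((Clique⇒⟶ G K ⊕ʰ Clique⇒⟶ H L) ∘ʰ splitAtʰ a b)

HasCliqueNumber-⟷ : {G H : Graph} {c : ℕ} → G ⟷ H → HasCliqueNumber G c → HasCliqueNumber H c
HasCliqueNumber-⟷ (G→H , H→G) (K , noClique) = Clique-map G→H K , λ L → noClique (Clique-map H→G L)

module _ (W : Graph) {S : Subset W} {r : ℕ} (rank : HasRank W S r) where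

  rank-clique : IsFlat W S → Clique (Induced W S) r
  rank-clique flat = Clique-map (Induced-⊆ W (flat-⊥⊥⊆ W flat)) (proj₁ rank)

  rank-bound : {m : ℕ} → Clique (Induced W S) m → m ≤ r
  rank-bound K = Clique-size≤ (Induced W (_⊥ W (_⊥ W S))) (Clique-map (Induced-⊆ W (⊆-⊥⊥ W)) K) (proj₂ rank)

rank-⊥-of-clique : (W : Graph) {B : Subset W} {a b r : ℕ} → ¬ Clique W (suc (a + b)) →
  Clique (Induced W (_⊥ W B)) a → Clique (Induced W B) b → HasRank W (_⊥ W B) r → r ≡ a
rank-⊥-of-clique W {B} {a} {b} {r} noClique Ka Kb rank = ≤-antisym r≤a (rank-bound W rank Ka)
  where
  r+b≤a+b : r + b ≤ a + b
  r+b≤a+b = Clique-size≤ W (Clique-map (Induced-⊕ W λ x⊥B → x⊥B) (Clique-⊕ (Induced W (_⊥ W B)) (Induced W B) (rank-clique W rank (⊥-isFlat W B)) Kb)) noClique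
  r≤a : r ≤ a
  r≤a = +-cancelʳ-≤ b r a r+b≤a+b

module LinearLikeFamily (F : ℕ → Graph) (SF : SemiringFamily F) (LL : LinearLike F) where
  open SemiringFamily SF

  flat-rank : ∀ n (S : Subset (F n)) → IsFlat (F n) S → ℕ
  flat-rank n S flat = proj₁ (LL n S flat)

  flat-hasRank : ∀ n S flat → HasRank (F n) S (flat-rank n S flat)
  flat-hasRank n S flat = proj₁ (proj₂ (LL n S flat))

  flat⟶F : ∀ n S flat → Induced (F n) S ⟶ F (flat-rank n S flat)
  flat⟶F n S flat = proj₁ (proj₂ (proj₂ (LL n S flat)))

  F⟶flat : ∀ n S flat → F (flat-rank n S flat) ⟶ Induced (F n) S
  F⟶flat n S flat = proj₂ (proj₂ (proj₂ (LL n S flat)))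

  flat-clique : ∀ n S flat → Clique (Induced (F n) S) (flat-rank n S flat)
  flat-clique n S flat = rank-clique (F n) (flat-hasRank n S flat) flat

  F-pad : ∀ k m → F k ⟶ F (k + m)
  F-pad k m = join-hom k m ∘ʰ inj₁ʰ

  cliqueNumber : ∀ n → ∃ λ c → HasCliqueNumber (F n) c
  cliqueNumber n = flat-rank n U U-isFlat ,
    HasCliqueNumber-⟷ (Induced-incl (F n) , corestrict (F n) idʰ (λ _ → ⊆-⊥⊥ (F n) tt))
      (flat-hasRank n U U-isFlat)
    where
    U-isFlat : IsFlat (F n) U
    U-isFlat v = (λ _ → tt) , λ _ u u⊥U → ⊥-elim (irr (F n) (u⊥U u tt))

  cliqueNumber≤ : ∀ n {c} → HasCliqueNumber (F n) c → c ≤ n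
  cliqueNumber≤ n {c} (K , noClique) with ≤-total c n
  ... | inj₁ c≤n = c≤n
  ... | inj₂ n≤c with m≤n⇒∃[o]m+o≡n n≤c
  ... | b , refl = ≤-trans (rank-bound W rank (Clique-map F⟶S K)) (≤-reflexive r≡n)
    where
    W : Graph
    W = F n
    κ : (Complete n ⊕ Complete b) ⟶ W
    κ = Clique⇒⟶ W K ∘ʰ joinʰ n b
    B S : Subset W
    B = Image W (κ ∘ʰ inj₂ʰ)
    S = _⊥ W B
    flat : IsFlat W S
    flat = ⊥-isFlat W B
    rank : HasRank W S (flat-rank n S flat)
    rank = flat-hasRank n S flat
    r≡n : flat-rank n S flat ≡ n
    r≡n = rank-⊥-of-clique W noClique
      (⟶⇒Clique (⊕⟶Image⊥ W κ)) (⟶⇒Clique (⊕⟶Image W κ)) rank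
    F⟶S : F n ⟶ Induced W S
    F⟶S = subst (λ r → F r ⟶ Induced W S) r≡n (F⟶flat n S flat)

  Clique-F-size≤ : ∀ n {m} → Clique (F n) m → m ≤ n
  Clique-F-size≤ n K with cliqueNumber n
  ... | c , ω@(_ , noClique) = ≤-trans (Clique-size≤ (F n) K noClique) (cliqueNumber≤ n ω)

lemma4p9 : (F : ℕ → Graph) → SemiringFamily F → LinearLike F →
    (G H : Graph) (n : ℕ) → (G ⊕ H) ⟶ F n →
    Σ ℕ λ k → Σ ℕ λ l → (n ≡ k + l) × (G ⟶ F k) × (H ⟶ F l)
lemma4p9 F SF LL G H n φ =
  let d , k+l+d≡n = m≤n⇒∃[o]m+o≡n k+l≤n
  in k , l + d , ≡-trans (≡-sym k+l+d≡n) (+-assoc k l d)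
   , flat⟶F n S S-flat ∘ʰ ⊕⟶Image⊥ W φ
   , F-pad l d ∘ʰ flat⟶F n T T-flat ∘ʰ Induced-⊆ W (⊆-⊥⊥ W) ∘ʰ ⊕⟶Image W φ
  where
  open LinearLikeFamily F SF LL
  W : Graph
  W = F n
  S T : Subset W
  S = _⊥ W (Image W (φ ∘ʰ inj₂ʰ))
  T = _⊥ W S
  S-flat : IsFlat W S
  S-flat = ⊥-isFlat W _
  T-flat : IsFlat W T
  T-flat = ⊥-isFlat W S
  k l : ℕ
  k = flat-rank n S S-flat
  l = flat-rank n T T-flat
  k+l≤n : k + l ≤ n
  k+l≤n = Clique-F-size≤ n (Clique-map (Induced-⊕ W (⊆-⊥⊥ W))
    (Clique-⊕ (Induced W S) (Induced W T) (flat-clique n S S-flat) (flat-clique n T T-flat)))
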